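{- Let $r$ be a complex number and $n\ge1$ an integer. Then, as polynomials in $x$, $$\sum_{k=0}^{n-1}(-1)^k(2k+2r+1)\frac{(k+1+2r)\cdots(n+2r)}{(k+1)\cdots n}d_k^{(r)}(x)^2=(-1)^n(n+2r)\big(n\,d_n^{(r)}(x)^2-(n+1)d_{n-1}^{(r)}(x)d_{n+1}^{(r)}(x)\big).$$
   Context: For a complex number $a$ and integer $k\ge0$, $\binom{a}{k}=a(a-1)\cdots(a-k+1)/k!$. For a parameter $r$ and an integer $n\ge 0$, $d_n^{(r)}(x)=\sum_{k=0}^n\binom{x+r+k}{k}\binom{x-r}{n-k}$. -}

module Defs where

open import Level using (Level)
open import Data.Nat using (ℕ; zero; suc; _∸_) renaming (_+_ to _+ℕ_)
open import Algebra.Bundles using (CommutativeRing)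

-- Everything is developed over a commutative ring R in which every positive
-- integer 1+m is invertible; `inv m` is the chosen inverse of (1+m).
module WithInv {c ℓ : Level} (R : CommutativeRing c ℓ)
               (inv : ℕ → CommutativeRing.Carrier R) where
  open CommutativeRing R

  ι : ℕ → Carrier
  ι zero    = 0#
  ι (suc m) = 1# + ι m

  sgn : ℕ → Carrier
  sgn zero    = 1#
  sgn (suc k) = - sgn k

  fall : Carrier → ℕ → Carrier
  fall a zero    = 1#
  fall a (suc k) = fall a k * (a - ι k)

  invFact : ℕ → Carrier
  invFact zero    = 1#
  invFact (suc k) = invFact k * inv k

  binom : Carrier → ℕ → Carrier
  binom a k = fall a k * invFact k

  sumBelow : ℕ → (ℕ → Carrier) → Carrier
  sumBelow zero    f = 0#
  sumBelow (suc n) f = sumBelow n f + f n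

  prodBelow : ℕ → (ℕ → Carrier) → Carrier
  prodBelow zero    f = 1#
  prodBelow (suc m) f = prodBelow m f * f m

  d : Carrier → ℕ → Carrier → Carrier
  d r n x = sumBelow (suc n) (λ k → binom (x + r + ι k) k * binom (x - r) (n ∸ k))

  -- (k+1+2r)...(n+2r) / ((k+1)...n) = Π_{j=k+1}^{n} (j+2r)/j
  ratio : Carrier → ℕ → ℕ → Carrier
  ratio r k n = prodBelow (n ∸ k) (λ i → (ι (suc (k +ℕ i)) + (r + r)) * inv (k +ℕ i))

-- The polynomials d_n satisfy the three-term recurrence
--   (n+1) d_{n+1} = (2x+1) d_n + (n+2r) d_{n-1},
-- obtained by writing the weight n+1 of the k-th term of d_{n+1} as k + (n+1-k) and absorbing
-- each part into one of the two binomial coefficients.  For any solution e of this recurrence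
-- the Turán-type expression W_n = (n+1) e_{n+1}^2 - (n+2) e_n e_{n+2} satisfies
--   (n+1+2r) W_n + (2n+3+2r) e_{n+1}^2 = -(n+2) W_{n+1},
-- so after multiplying by (n+2+2r)/(n+2) both sides of the identity obey the same first-order
-- recurrence in n.
module Submission where

open import Level using (Level)
open import Algebra.Bundles using (CommutativeRing)
open import Data.Nat as ℕ using (ℕ; zero; suc; _∸_; _≤_; _<_; s≤s) renaming (_+_ to _+ℕ_)
open import Data.Nat.Properties using (+-suc; +-∸-assoc; m+[n∸m]≡n; n∸n≡0; m<n⇒m<1+n; n<1+n)
open import Data.Integer as ℤ using (ℤ; +_; -[1+_]; _⊖_)
import Data.Integer.Properties as ℤ
import Data.Sign as Sign
open import Data.Maybe using (Maybe; just; nothing)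
open import Relation.Nullary using (yes; no)
open import Relation.Binary.PropositionalEquality using (cong)
open import Algebra.Solver.Ring.AlmostCommutativeRing using (fromCommutativeRing; _-Raw-AlmostCommutative⟶_)
import Algebra.Solver.Ring
open import Defs

module IntegerCoefficientRingSolver {c ℓ : Level} (R : CommutativeRing c ℓ) where
  open CommutativeRing R
  open import Algebra.Properties.Semiring.Mult.TCOptimised semiring using (_×_; 1+×; ×-homo-+; ×1-homo-*)
  open import Algebra.Properties.Ring ring using (-‿distribˡ-*; -‿distribʳ-*)
  open import Algebra.Properties.AbelianGroup +-abelianGroup using (ε⁻¹≈ε; ⁻¹-involutive; ⁻¹-∙-comm)
  open import Algebra.Properties.CommutativeSemigroup +-commutativeSemigroup using (interchange)
  open import Relation.Binary.Reasoning.Setoid setoid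

  -- With the optimised _×_, fromℤ (+ 1) reduces to 1#, so the constant :1 below denotes 1#
  -- on the nose and solved equations match goals written with 1#.
  fromℤ : ℤ → Carrier
  fromℤ (+ n)    = n × 1#
  fromℤ -[1+ n ] = - (suc n × 1#)

  x≈x-0 : ∀ x → x ≈ x - 0#
  x≈x-0 x = sym (trans (+-congˡ ε⁻¹≈ε) (+-identityʳ x))

  [x+y]-[x+z]≈y-z : ∀ x y z → (x + y) - (x + z) ≈ y - z
  [x+y]-[x+z]≈y-z x y z = begin
    (x + y) - (x + z)     ≈⟨ +-congˡ (⁻¹-∙-comm x z) ⟨
    (x + y) + (- x + - z) ≈⟨ interchange x y (- x) (- z) ⟩
    (x - x) + (y - z)     ≈⟨ +-congʳ (-‿inverseʳ x) ⟩
    0# + (y - z)          ≈⟨ +-identityˡ _ ⟩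
    y - z                 ∎

  fromℤ-⊖ : ∀ m n → fromℤ (m ⊖ n) ≈ m × 1# - n × 1#
  fromℤ-⊖ zero    zero    = x≈x-0 0#
  fromℤ-⊖ zero    (suc n) = sym (+-identityˡ _)
  fromℤ-⊖ (suc m) zero    = x≈x-0 _
  fromℤ-⊖ (suc m) (suc n) = begin
    fromℤ (suc m ⊖ suc n)           ≡⟨ cong fromℤ (ℤ.[1+m]⊖[1+n]≡m⊖n m n) ⟩
    fromℤ (m ⊖ n)                   ≈⟨ fromℤ-⊖ m n ⟩
    m × 1# - n × 1#                 ≈⟨ [x+y]-[x+z]≈y-z 1# _ _ ⟨
    (1# + m × 1#) - (1# + n × 1#)   ≈⟨ +-cong (1+× m 1#) (-‿cong (1+× n 1#)) ⟨
    suc m × 1# - suc n × 1#         ∎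

  fromℤ-+ : ∀ i j → fromℤ (i ℤ.+ j) ≈ fromℤ i + fromℤ j
  fromℤ-+ -[1+ m ] -[1+ n ] = begin
    - (suc (suc (m ℕ.+ n)) × 1#)        ≡⟨ cong (λ k → - (suc k × 1#)) (+-suc m n) ⟨
    - ((suc m ℕ.+ suc n) × 1#)          ≈⟨ -‿cong (×-homo-+ 1# (suc m) (suc n)) ⟩
    - (suc m × 1# + suc n × 1#)         ≈⟨ ⁻¹-∙-comm _ _ ⟨
    - (suc m × 1#) + - (suc n × 1#)     ∎
  fromℤ-+ -[1+ m ] (+ n)    = trans (fromℤ-⊖ n (suc m)) (+-comm _ _)
  fromℤ-+ (+ m)    -[1+ n ] = fromℤ-⊖ m (suc n)
  fromℤ-+ (+ m)    (+ n)    = ×-homo-+ 1# m n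

  fromℤ-neg : ∀ i → fromℤ (ℤ.- i) ≈ - fromℤ i
  fromℤ-neg -[1+ n ]  = sym (⁻¹-involutive _)
  fromℤ-neg (+ zero)  = sym ε⁻¹≈ε
  fromℤ-neg (+ suc n) = refl

  fromℤ-pos◃ : ∀ n → fromℤ (Sign.+ ℤ.◃ n) ≈ n × 1#
  fromℤ-pos◃ zero    = refl
  fromℤ-pos◃ (suc n) = refl

  fromℤ-neg◃ : ∀ n → fromℤ (Sign.- ℤ.◃ n) ≈ - (n × 1#)
  fromℤ-neg◃ zero    = sym ε⁻¹≈ε
  fromℤ-neg◃ (suc n) = refl

  -x*-y≈x*y : ∀ x y → - x * - y ≈ x * y
  -x*-y≈x*y x y = begin
    - x * - y     ≈⟨ -‿distribˡ-* x (- y) ⟨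
    - (x * - y)   ≈⟨ -‿cong (-‿distribʳ-* x y) ⟨
    - - (x * y)   ≈⟨ ⁻¹-involutive _ ⟩
    x * y         ∎

  fromℤ-* : ∀ i j → fromℤ (i ℤ.* j) ≈ fromℤ i * fromℤ j
  fromℤ-* -[1+ m ] -[1+ n ] = trans (fromℤ-pos◃ (suc m ℕ.* suc n))
    (trans (×1-homo-* (suc m) (suc n)) (sym (-x*-y≈x*y _ _)))
  fromℤ-* -[1+ m ] (+ n)    = trans (fromℤ-neg◃ (suc m ℕ.* n))
    (trans (-‿cong (×1-homo-* (suc m) n)) (-‿distribˡ-* _ _))
  fromℤ-* (+ m)    -[1+ n ] = trans (fromℤ-neg◃ (m ℕ.* suc n))
    (trans (-‿cong (×1-homo-* m (suc n))) (-‿distribʳ-* _ _))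
  fromℤ-* (+ m)    (+ n)    = trans (fromℤ-pos◃ (m ℕ.* n)) (×1-homo-* m n)

  homomorphism : CommutativeRing.rawRing ℤ.+-*-commutativeRing -Raw-AlmostCommutative⟶ fromCommutativeRing R
  homomorphism = record
    { ⟦_⟧    = fromℤ
    ; +-homo = fromℤ-+
    ; *-homo = fromℤ-*
    ; -‿homo = fromℤ-neg
    ; 0-homo = refl
    ; 1-homo = refl
    }

  fromℤ-≟ : ∀ i j → Maybe (fromℤ i ≈ fromℤ j)
  fromℤ-≟ i j with i ℤ.≟ j
  ... | yes i≡j = just (reflexive (cong fromℤ i≡j))
  ... | no _    = nothing

  open Algebra.Solver.Ring _ (fromCommutativeRing R) homomorphism fromℤ-≟
    public using (Polynomial; solve; _:=_; con; _:+_; _:*_; _:-_; :-_)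

  :0 :1 : ∀ {n} → Polynomial n
  :0 = con (+ 0)
  :1 = con (+ 1)

module _ {c ℓ : Level} (R : CommutativeRing c ℓ) (inv : ℕ → CommutativeRing.Carrier R) where
  open CommutativeRing R
  open WithInv R inv
  open IntegerCoefficientRingSolver R
  open import Algebra.Properties.AbelianGroup +-abelianGroup using (⁻¹-∙-comm)
  open import Algebra.Properties.Group +-group using (x≈y⇒x∙y⁻¹≈ε)
  import Algebra.Properties.CommutativeSemigroup as CommutativeSemigroupProperties
  module +-Properties = CommutativeSemigroupProperties +-commutativeSemigroup
  module *-Properties = CommutativeSemigroupProperties *-commutativeSemigroup
  open import Relation.Binary.Reasoning.Setoid setoid

  sumBelow-cong : ∀ n {f g : ℕ → Carrier} → (∀ k → k < n → f k ≈ g k) → sumBelow n f ≈ sumBelow n g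
  sumBelow-cong zero    f≈g = refl
  sumBelow-cong (suc n) f≈g =
    +-cong (sumBelow-cong n (λ k k<n → f≈g k (m<n⇒m<1+n k<n))) (f≈g n (n<1+n n))

  sumBelow-+ : ∀ n (f g : ℕ → Carrier) → sumBelow n (λ k → f k + g k) ≈ sumBelow n f + sumBelow n g
  sumBelow-+ zero    f g = sym (+-identityʳ 0#)
  sumBelow-+ (suc n) f g = trans (+-congʳ (sumBelow-+ n f g)) (+-Properties.interchange _ _ _ _)

  sumBelow-- : ∀ n (f g : ℕ → Carrier) → sumBelow n (λ k → f k - g k) ≈ sumBelow n f - sumBelow n g
  sumBelow-- zero    f g = sym (-‿inverseʳ 0#)
  sumBelow-- (suc n) f g = begin
    sumBelow n (λ k → f k - g k) + (f n - g n)        ≈⟨ +-congʳ (sumBelow-- n f g) ⟩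
    (sumBelow n f - sumBelow n g) + (f n - g n)        ≈⟨ +-Properties.interchange _ _ _ _ ⟩
    (sumBelow n f + f n) + (- sumBelow n g + - g n)    ≈⟨ +-congˡ (⁻¹-∙-comm _ _) ⟩
    (sumBelow n f + f n) - (sumBelow n g + g n)        ∎

  *-distribˡ-sumBelow : ∀ n x (f : ℕ → Carrier) → x * sumBelow n f ≈ sumBelow n (λ k → x * f k)
  *-distribˡ-sumBelow zero    x f = zeroʳ x
  *-distribˡ-sumBelow (suc n) x f = trans (distribˡ x _ _) (+-congʳ (*-distribˡ-sumBelow n x f))

  sumBelow-suc-head : ∀ n (f : ℕ → Carrier) → sumBelow (suc n) f ≈ f 0 + sumBelow n (λ k → f (suc k))
  sumBelow-suc-head zero    f = +-comm 0# (f 0)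
  sumBelow-suc-head (suc n) f = trans (+-congʳ (sumBelow-suc-head n f)) (+-assoc _ _ _)

  ι-+ : ∀ m n → ι (m +ℕ n) ≈ ι m + ι n
  ι-+ zero    n = sym (+-identityˡ (ι n))
  ι-+ (suc m) n = trans (+-congˡ (ι-+ m n)) (sym (+-assoc 1# (ι m) (ι n)))

  ι-+-∸ : ∀ {k n} → k ≤ n → ι k + ι (n ∸ k) ≈ ι n
  ι-+-∸ {k} {n} k≤n = trans (sym (ι-+ k (n ∸ k))) (reflexive (cong ι (m+[n∸m]≡n k≤n)))

  fall-cong : ∀ k {a b} → a ≈ b → fall a k ≈ fall b k
  fall-cong zero    a≈b = refl
  fall-cong (suc k) a≈b = *-cong (fall-cong k a≈b) (+-congʳ a≈b)

  fall-+1 : ∀ a k → fall (a + 1#) (suc k) ≈ (a + 1#) * fall a k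
  fall-+1 a zero    = solve 1 (λ a → :1 :* (a :+ :1 :- :0) := (a :+ :1) :* :1) refl a
  fall-+1 a (suc k) = begin
    fall (a + 1#) (suc k) * (a + 1# - ι (suc k))       ≈⟨ *-congʳ (fall-+1 a k) ⟩
    (a + 1#) * fall a k * (a + 1# - (1# + ι k))
      ≈⟨ solve 3 (λ a f i → (a :+ :1) :* f :* (a :+ :1 :- (:1 :+ i))
                            := (a :+ :1) :* (f :* (a :- i))) refl a (fall a k) (ι k) ⟩
    (a + 1#) * fall a (suc k)                          ∎

  ratio-suc : ∀ r {k n} → k ≤ n → ratio r k (suc n) ≈ ratio r k n * ((ι (suc n) + (r + r)) * inv n)
  ratio-suc r {k} {n} k≤n = begin
    prodBelow (suc n ∸ k) factor
      ≡⟨ cong (λ j → prodBelow j factor) (+-∸-assoc 1 k≤n) ⟩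
    prodBelow (n ∸ k) factor * factor (n ∸ k)
      ≡⟨ cong (λ j → ratio r k n * ((ι (suc j) + (r + r)) * inv j)) (m+[n∸m]≡n k≤n) ⟩
    ratio r k n * ((ι (suc n) + (r + r)) * inv n) ∎
    where
    factor : ℕ → Carrier
    factor i = (ι (suc (k +ℕ i)) + (r + r)) * inv (k +ℕ i)

  ratio-self : ∀ r n → ratio r n n ≈ 1#
  ratio-self r n = reflexive (cong (λ j → prodBelow j factor) (n∸n≡0 n))
    where
    factor : ℕ → Carrier
    factor i = (ι (suc (n +ℕ i)) + (r + r)) * inv (n +ℕ i)

  sumBelow-ratio-suc : ∀ r n (a b : ℕ → Carrier) →
    sumBelow (suc n) (λ k → a k * ratio r k (suc n) * b k)
      ≈ (ι (suc n) + (r + r)) * inv n * (sumBelow n (λ k → a k * ratio r k n * b k) + a n * b n)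
  sumBelow-ratio-suc r n a b = begin
    sumBelow (suc n) (λ k → a k * ratio r k (suc n) * b k)
      ≈⟨ sumBelow-cong (suc n) (λ { k (s≤s k≤n) → trans (*-congʳ (*-congˡ (ratio-suc r k≤n)))
           (solve 4 (λ a ρ c b → a :* (ρ :* c) :* b := c :* (a :* ρ :* b))
              refl (a k) (ratio r k n) γ (b k)) }) ⟩
    sumBelow (suc n) (λ k → γ * (a k * ratio r k n * b k))
      ≈⟨ *-distribˡ-sumBelow (suc n) γ _ ⟨
    γ * (sumBelow n (λ k → a k * ratio r k n * b k) + a n * ratio r n n * b n)
      ≈⟨ *-congˡ (+-congˡ (*-congʳ (trans (*-congˡ (ratio-self r n)) (*-identityʳ (a n))))) ⟩
    γ * (sumBelow n (λ k → a k * ratio r k n * b k) + a n * b n) ∎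
    where
    γ : Carrier
    γ = (ι (suc n) + (r + r)) * inv n

  cancel-residuals : ∀ {a b c d} x p q → a ≈ b → c ≈ d → x + (p * (a - b) - q * (c - d)) ≈ x
  cancel-residuals x p q a≈b c≈d = begin
    x + (p * (_ - _) - q * (_ - _))
      ≈⟨ +-congˡ (+-cong (*-congˡ (x≈y⇒x∙y⁻¹≈ε a≈b)) (-‿cong (*-congˡ (x≈y⇒x∙y⁻¹≈ε c≈d)))) ⟩
    x + (p * 0# - q * 0#)
      ≈⟨ solve 3 (λ x p q → x :+ (p :* :0 :- q :* :0) := x) refl x p q ⟩
    x ∎

  -- The left side minus the right side equals (1+N)e₂ times the residual of the first
  -- hypothesis minus (1+N)e₁ times the residual of the second.
  turán-step : ∀ N s y e₀ e₁ e₂ e₃ →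
    (1# + N) * e₂ ≈ y * e₁ + (N + s) * e₀ →
    (1# + (1# + N)) * e₃ ≈ y * e₂ + ((1# + N) + s) * e₁ →
    (N + s) * (N * (e₁ * e₁) - (1# + N) * (e₀ * e₂)) + (N + N + s + 1#) * (e₁ * e₁)
      ≈ - ((1# + N) * ((1# + N) * (e₂ * e₂) - (1# + (1# + N)) * (e₁ * e₃)))
  turán-step N s y e₀ e₁ e₂ e₃ rec₂ rec₃ = begin
    (N + s) * (N * (e₁ * e₁) - (1# + N) * (e₀ * e₂)) + (N + N + s + 1#) * (e₁ * e₁)
      ≈⟨ solve 7 (λ N s y e₀ e₁ e₂ e₃ →
           (N :+ s) :* (N :* (e₁ :* e₁) :- (:1 :+ N) :* (e₀ :* e₂)) :+ (N :+ N :+ s :+ :1) :* (e₁ :* e₁)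
           := :- ((:1 :+ N) :* ((:1 :+ N) :* (e₂ :* e₂) :- (:1 :+ (:1 :+ N)) :* (e₁ :* e₃)))
              :+ ((:1 :+ N) :* e₂ :* ((:1 :+ N) :* e₂ :- (y :* e₁ :+ (N :+ s) :* e₀))
                  :- (:1 :+ N) :* e₁ :* ((:1 :+ (:1 :+ N)) :* e₃ :- (y :* e₂ :+ ((:1 :+ N) :+ s) :* e₁))))
           refl N s y e₀ e₁ e₂ e₃ ⟩
    - ((1# + N) * ((1# + N) * (e₂ * e₂) - (1# + (1# + N)) * (e₁ * e₃)))
      + ((1# + N) * e₂ * ((1# + N) * e₂ - (y * e₁ + (N + s) * e₀))
         - (1# + N) * e₁ * ((1# + (1# + N)) * e₃ - (y * e₂ + ((1# + N) + s) * e₁)))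
      ≈⟨ cancel-residuals _ _ _ rec₂ rec₃ ⟩
    - ((1# + N) * ((1# + N) * (e₂ * e₂) - (1# + (1# + N)) * (e₁ * e₃))) ∎

  module _ (inv-correct : ∀ m → ι (suc m) * inv m ≈ 1#) where

    *-ι-inv-cancel : ∀ m x → x * (ι (suc m) * inv m) ≈ x
    *-ι-inv-cancel m x = trans (*-congˡ (inv-correct m)) (*-identityʳ x)

    ι-*-binom-suc : ∀ a k → ι (suc k) * binom a (suc k) ≈ fall a (suc k) * invFact k
    ι-*-binom-suc a k = begin
      ι (suc k) * (fall a (suc k) * (invFact k * inv k))
        ≈⟨ solve 4 (λ n f i j → n :* (f :* (i :* j)) := f :* i :* (n :* j))
             refl (ι (suc k)) (fall a (suc k)) (invFact k) (inv k) ⟩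
      fall a (suc k) * invFact k * (ι (suc k) * inv k)
        ≈⟨ *-ι-inv-cancel k _ ⟩
      fall a (suc k) * invFact k ∎

    binom-absorb : ∀ a k → ι (suc k) * binom a (suc k) ≈ (a - ι k) * binom a k
    binom-absorb a k = trans (ι-*-binom-suc a k) (*-Properties.xy∙z≈y∙xz (fall a k) (a - ι k) (invFact k))

    binom-absorb-upper : ∀ a k →
      ι (suc k) * binom (a + ι (suc k)) (suc k) ≈ (a + ι k + 1#) * binom (a + ι k) k
    binom-absorb-upper a k = begin
      ι (suc k) * binom (a + ι (suc k)) (suc k)
        ≈⟨ ι-*-binom-suc _ k ⟩
      fall (a + (1# + ι k)) (suc k) * invFact k
        ≈⟨ *-congʳ (fall-cong (suc k) (+-Properties.x∙yz≈xz∙y a 1# (ι k))) ⟩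
      fall (a + ι k + 1#) (suc k) * invFact k
        ≈⟨ *-congʳ (fall-+1 (a + ι k) k) ⟩
      (a + ι k + 1#) * fall (a + ι k) k * invFact k
        ≈⟨ *-assoc _ _ _ ⟩
      (a + ι k + 1#) * binom (a + ι k) k ∎

    module DRecurrence (r x : Carrier) where

      u v y : Carrier
      u = x + r
      v = x - r
      y = x + x + 1#

      term : ℕ → ℕ → Carrier
      term n k = binom (u + ι k) k * binom v (n ∸ k)

      lowerWeighted upperWeighted : ℕ → Carrier
      lowerWeighted n = sumBelow (suc n) (λ k → ι k * term n k)
      upperWeighted n = sumBelow (suc n) (λ k → ι (n ∸ k) * term n k)

      weighted-+ : ∀ n → lowerWeighted n + upperWeighted n ≈ ι n * d r n x
      weighted-+ n = begin
        lowerWeighted n + upperWeighted n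
          ≈⟨ sumBelow-+ (suc n) _ _ ⟨
        sumBelow (suc n) (λ k → ι k * term n k + ι (n ∸ k) * term n k)
          ≈⟨ sumBelow-cong (suc n) (λ { k (s≤s k≤n) → trans (sym (distribʳ _ _ _)) (*-congʳ (ι-+-∸ k≤n)) }) ⟩
        sumBelow (suc n) (λ k → ι n * term n k)
          ≈⟨ *-distribˡ-sumBelow (suc n) (ι n) (term n) ⟨
        ι n * d r n x ∎

      lowerWeighted-suc : ∀ n → lowerWeighted (suc n) ≈ (u + 1#) * d r n x + lowerWeighted n
      lowerWeighted-suc n = begin
        lowerWeighted (suc n)
          ≈⟨ sumBelow-suc-head (suc n) _ ⟩
        0# * term (suc n) 0 + sumBelow (suc n) (λ k → ι (suc k) * term (suc n) (suc k))
          ≈⟨ trans (+-congʳ (zeroˡ _)) (+-identityˡ _) ⟩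
        sumBelow (suc n) (λ k → ι (suc k) * term (suc n) (suc k))
          ≈⟨ sumBelow-cong (suc n) (λ k _ → absorb k) ⟩
        sumBelow (suc n) (λ k → (u + 1#) * term n k + ι k * term n k)
          ≈⟨ sumBelow-+ (suc n) _ _ ⟩
        sumBelow (suc n) (λ k → (u + 1#) * term n k) + lowerWeighted n
          ≈⟨ +-congʳ (*-distribˡ-sumBelow (suc n) (u + 1#) (term n)) ⟨
        (u + 1#) * d r n x + lowerWeighted n ∎
        where
        absorb : ∀ k → ι (suc k) * term (suc n) (suc k) ≈ (u + 1#) * term n k + ι k * term n k
        absorb k = begin
          ι (suc k) * (binom (u + ι (suc k)) (suc k) * binom v (n ∸ k))
            ≈⟨ *-assoc _ _ _ ⟨
          ι (suc k) * binom (u + ι (suc k)) (suc k) * binom v (n ∸ k)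
            ≈⟨ *-congʳ (binom-absorb-upper u k) ⟩
          (u + ι k + 1#) * binom (u + ι k) k * binom v (n ∸ k)
            ≈⟨ solve 4 (λ u i a b → (u :+ i :+ :1) :* a :* b := (u :+ :1) :* (a :* b) :+ i :* (a :* b))
                 refl u (ι k) (binom (u + ι k) k) (binom v (n ∸ k)) ⟩
          (u + 1#) * term n k + ι k * term n k ∎

      upperWeighted-suc : ∀ n → upperWeighted (suc n) ≈ v * d r n x - upperWeighted n
      upperWeighted-suc n = begin
        sumBelow (suc n) (λ k → ι (suc n ∸ k) * term (suc n) k) + ι (n ∸ n) * term (suc n) (suc n)
          ≈⟨ +-congˡ (trans (*-congʳ (reflexive (cong ι (n∸n≡0 n)))) (zeroˡ _)) ⟩
        sumBelow (suc n) (λ k → ι (suc n ∸ k) * term (suc n) k) + 0#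
          ≈⟨ +-identityʳ _ ⟩
        sumBelow (suc n) (λ k → ι (suc n ∸ k) * term (suc n) k)
          ≈⟨ sumBelow-cong (suc n) (λ { k (s≤s k≤n) → absorb k≤n }) ⟩
        sumBelow (suc n) (λ k → v * term n k - ι (n ∸ k) * term n k)
          ≈⟨ sumBelow-- (suc n) _ _ ⟩
        sumBelow (suc n) (λ k → v * term n k) - upperWeighted n
          ≈⟨ +-congʳ (*-distribˡ-sumBelow (suc n) v (term n)) ⟨
        v * d r n x - upperWeighted n ∎
        where
        absorb : ∀ {k} → k ≤ n → ι (suc n ∸ k) * term (suc n) k ≈ v * term n k - ι (n ∸ k) * term n k
        absorb {k} k≤n = begin
          ι (suc n ∸ k) * (binom (u + ι k) k * binom v (suc n ∸ k))
            ≡⟨ cong (λ j → ι j * (binom (u + ι k) k * binom v j)) (+-∸-assoc 1 k≤n) ⟩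
          ι (suc (n ∸ k)) * (binom (u + ι k) k * binom v (suc (n ∸ k)))
            ≈⟨ *-Properties.x∙yz≈y∙xz _ _ _ ⟩
          binom (u + ι k) k * (ι (suc (n ∸ k)) * binom v (suc (n ∸ k)))
            ≈⟨ *-congˡ (binom-absorb v (n ∸ k)) ⟩
          binom (u + ι k) k * ((v - ι (n ∸ k)) * binom v (n ∸ k))
            ≈⟨ solve 4 (λ a v j b → a :* ((v :- j) :* b) := v :* (a :* b) :- j :* (a :* b))
                 refl (binom (u + ι k) k) v (ι (n ∸ k)) (binom v (n ∸ k)) ⟩
          v * term n k - ι (n ∸ k) * term n k ∎

      d-suc : ∀ n → ι (suc n) * d r (suc n) x ≈ y * d r n x + (lowerWeighted n - upperWeighted n)
      d-suc n = begin
        ι (suc n) * d r (suc n) x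
          ≈⟨ weighted-+ (suc n) ⟨
        lowerWeighted (suc n) + upperWeighted (suc n)
          ≈⟨ +-cong (lowerWeighted-suc n) (upperWeighted-suc n) ⟩
        (u + 1#) * d r n x + lowerWeighted n + (v * d r n x - upperWeighted n)
          ≈⟨ solve 5 (λ x r d l w → (x :+ r :+ :1) :* d :+ l :+ ((x :- r) :* d :- w)
                                    := (x :+ x :+ :1) :* d :+ (l :- w))
               refl x r (d r n x) (lowerWeighted n) (upperWeighted n) ⟩
        y * d r n x + (lowerWeighted n - upperWeighted n) ∎

      weighted-difference-suc : ∀ n →
        lowerWeighted (suc n) - upperWeighted (suc n) ≈ (ι (suc n) + (r + r)) * d r n x
      weighted-difference-suc n = begin
        lowerWeighted (suc n) - upperWeighted (suc n)
          ≈⟨ +-cong (lowerWeighted-suc n) (-‿cong (upperWeighted-suc n)) ⟩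
        (u + 1#) * d r n x + lowerWeighted n - (v * d r n x - upperWeighted n)
          ≈⟨ solve 5 (λ x r d l w → (x :+ r :+ :1) :* d :+ l :- ((x :- r) :* d :- w)
                                    := (:1 :+ (r :+ r)) :* d :+ (l :+ w))
               refl x r (d r n x) (lowerWeighted n) (upperWeighted n) ⟩
        (1# + (r + r)) * d r n x + (lowerWeighted n + upperWeighted n)
          ≈⟨ +-congˡ (weighted-+ n) ⟩
        (1# + (r + r)) * d r n x + ι n * d r n x
          ≈⟨ solve 3 (λ r i d → (:1 :+ (r :+ r)) :* d :+ i :* d := (:1 :+ i :+ (r :+ r)) :* d)
               refl r (ι n) (d r n x) ⟩
        (ι (suc n) + (r + r)) * d r n x ∎

      d-rec-one : ι 1 * d r 1 x ≈ y * d r 0 x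
      d-rec-one = trans (d-suc 0) (trans (+-congˡ (-‿inverseʳ _)) (+-identityʳ _))

      d-rec : ∀ n → ι (suc (suc n)) * d r (suc (suc n)) x ≈ y * d r (suc n) x + (ι (suc n) + (r + r)) * d r n x
      d-rec n = trans (d-suc (suc n)) (+-congˡ (weighted-difference-suc n))

    module ChristoffelDarboux (r y : Carrier) (e : ℕ → Carrier)
      (rec-one : ι 1 * e 1 ≈ y * e 0)
      (rec : ∀ n → ι (suc (suc n)) * e (suc (suc n)) ≈ y * e (suc n) + (ι (suc n) + (r + r)) * e n)
      where

      turán : ℕ → Carrier
      turán n = ι (suc n) * (e (suc n) * e (suc n)) - ι (suc (suc n)) * (e n * e (suc (suc n)))

      weight : ℕ → Carrier
      weight k = ι (k +ℕ k) + (r + r) + 1#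

      turán-zero : turán 0 ≈ - ((ι 1 + (r + r)) * (e 0 * e 0))
      turán-zero = begin
        turán 0
          ≈⟨ solve 5 (λ s y e₀ e₁ e₂ →
               (:1 :+ :0) :* (e₁ :* e₁) :- (:1 :+ (:1 :+ :0)) :* (e₀ :* e₂)
               := :- (((:1 :+ :0) :+ s) :* (e₀ :* e₀))
                  :+ (e₁ :* ((:1 :+ :0) :* e₁ :- y :* e₀)
                      :- e₀ :* ((:1 :+ (:1 :+ :0)) :* e₂ :- (y :* e₁ :+ ((:1 :+ :0) :+ s) :* e₀))))
               refl (r + r) y (e 0) (e 1) (e 2) ⟩
        - ((ι 1 + (r + r)) * (e 0 * e 0))
          + (e 1 * (ι 1 * e 1 - y * e 0) - e 0 * (ι 2 * e 2 - (y * e 1 + (ι 1 + (r + r)) * e 0)))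
          ≈⟨ cancel-residuals _ _ _ rec-one (rec 0) ⟩
        - ((ι 1 + (r + r)) * (e 0 * e 0)) ∎

      turán-suc : ∀ n → (ι (suc n) + (r + r)) * turán n + weight (suc n) * (e (suc n) * e (suc n))
                          ≈ - (ι (suc (suc n)) * turán (suc n))
      turán-suc n = trans (+-congˡ (*-congʳ (+-congʳ (+-congʳ (ι-+ (suc n) (suc n))))))
                          (turán-step (ι (suc n)) (r + r) y _ _ _ _ (rec n) (rec (suc n)))

      christoffelDarboux : ∀ n → sumBelow (suc n) (λ k → sgn k * weight k * ratio r k (suc n) * (e k * e k))
                                   ≈ sgn (suc n) * (ι (suc n) + (r + r)) * turán n
      christoffelDarboux zero = begin
        0# + 1# * weight 0 * (1# * ((ι 1 + (r + r)) * inv 0)) * (e 0 * e 0)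
          ≈⟨ solve 3 (λ s i p → :0 :+ :1 :* (:0 :+ s :+ :1) :* (:1 :* (((:1 :+ :0) :+ s) :* i)) :* p
                                := (:- :1) :* ((:1 :+ :0) :+ s) :* (:- (((:1 :+ :0) :+ s) :* p)) :* ((:1 :+ :0) :* i))
               refl (r + r) (inv 0) (e 0 * e 0) ⟩
        sgn 1 * (ι 1 + (r + r)) * (- ((ι 1 + (r + r)) * (e 0 * e 0))) * (ι 1 * inv 0)
          ≈⟨ *-ι-inv-cancel 0 _ ⟩
        sgn 1 * (ι 1 + (r + r)) * (- ((ι 1 + (r + r)) * (e 0 * e 0)))
          ≈⟨ *-congˡ turán-zero ⟨
        sgn 1 * (ι 1 + (r + r)) * turán 0 ∎
      christoffelDarboux (suc n) = begin
        sumBelow (suc (suc n)) (λ k → sgn k * weight k * ratio r k (suc (suc n)) * (e k * e k))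
          ≈⟨ sumBelow-ratio-suc r (suc n) (λ k → sgn k * weight k) (λ k → e k * e k) ⟩
        γ * (sumBelow (suc n) (λ k → sgn k * weight k * ratio r k (suc n) * (e k * e k))
             + sgn (suc n) * weight (suc n) * e²)
          ≈⟨ *-congˡ (+-congʳ (christoffelDarboux n)) ⟩
        γ * (sgn (suc n) * (ι (suc n) + (r + r)) * turán n + sgn (suc n) * weight (suc n) * e²)
          ≈⟨ solve 8 (λ M s i σ N t w p → (M :+ s) :* i :* (σ :* (N :+ s) :* t :+ σ :* w :* p)
                                          := σ :* (M :+ s) :* ((N :+ s) :* t :+ w :* p) :* i)
               refl (ι (suc (suc n))) (r + r) (inv (suc n)) (sgn (suc n))
                    (ι (suc n)) (turán n) (weight (suc n)) e² ⟩
        sgn (suc n) * (ι (suc (suc n)) + (r + r))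
          * ((ι (suc n) + (r + r)) * turán n + weight (suc n) * e²) * inv (suc n)
          ≈⟨ *-congʳ (*-congˡ (turán-suc n)) ⟩
        sgn (suc n) * (ι (suc (suc n)) + (r + r)) * (- (ι (suc (suc n)) * turán (suc n))) * inv (suc n)
          ≈⟨ solve 5 (λ σ M s t i → σ :* (M :+ s) :* (:- (M :* t)) :* i := (:- σ) :* (M :+ s) :* t :* (M :* i))
               refl (sgn (suc n)) (ι (suc (suc n))) (r + r) (turán (suc n)) (inv (suc n)) ⟩
        sgn (suc (suc n)) * (ι (suc (suc n)) + (r + r)) * turán (suc n) * (ι (suc (suc n)) * inv (suc n))
          ≈⟨ *-ι-inv-cancel (suc n) _ ⟩
        sgn (suc (suc n)) * (ι (suc (suc n)) + (r + r)) * turán (suc n) ∎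
        where
        γ e² : Carrier
        γ  = (ι (suc (suc n)) + (r + r)) * inv (suc n)
        e² = e (suc n) * e (suc n)

corollary3p1 : ∀ {c ℓ} (R : CommutativeRing c ℓ) (inv : ℕ → CommutativeRing.Carrier R) →
    let open CommutativeRing R
        open WithInv R inv
    in (∀ m → ι (suc m) * inv m ≈ 1#) →
       ∀ (r x : Carrier) (n : ℕ) → 1 ≤ n →
       sumBelow n (λ k → sgn k * (ι (k +ℕ k) + (r + r) + 1#) * ratio r k n * (d r k x * d r k x))
         ≈ sgn n * (ι n + (r + r))
             * (ι n * (d r n x * d r n x) - ι (suc n) * (d r (n ∸ 1) x * d r (suc n) x))
corollary3p1 R inv inv-correct r x (suc n) _ = christoffelDarboux n
  where
  open DRecurrence R inv inv-correct r x
  open ChristoffelDarboux R inv inv-correct r y (λ k → WithInv.d R inv r k x) d-rec-one d-rec
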